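{- For every clause-set $F$ we have $D(F)\subseteq\mathrm{prc}_0(D(F))$, and every element of $D(F)$ is an essential prime implicate of $D(F)$.
   Context: Clauses are finite sets of literals without complementary pair; clause-sets finite sets of clauses. $\mathrm{prc}_0(G)$: prime implicates of $G$ (inclusion-minimal clauses implied by $G$); two clause-sets are equivalent iff they have the same prime implicates. A prime implicate $C$ of $G$ is essential if $\mathrm{prc}_0(G)\setminus\{C\}$ is not equivalent to $G$. Doping: each clause $C\in F$ gets a distinct new variable $u_C\notin\mathrm{var}(F)$, and $D(F):=\{C\cup\{u_C\}: C\in F\}$. -}

module Defs where

open import Data.Nat using (ℕ)
open import Data.Bool using (Bool; true; false; not)
open import Data.List using (List; []; _∷_; map)
open import Data.List.Membership.Propositional using (_∈_)
open import Data.Product using (Σ; _×_; _,_)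
open import Relation.Binary.PropositionalEquality using (_≡_)
open import Relation.Nullary using (¬_)

-- Literals: a variable (natural number) with a sign (true = positive).
record Lit : Set where
  constructor lit
  field
    var  : ℕ
    sign : Bool
open Lit public

compl : Lit → Lit
compl (lit v s) = lit v (not s)

-- A (finite) set of literals is represented by a list; only membership matters.
Clause : Set
Clause = List Lit

ClauseSet : Set
ClauseSet = List Clause

-- Arbitrary (possibly non-finite) sets of clauses, as predicates;
-- needed for sets like prc0(G) \ {C}.
ClausePred : Set₁
ClausePred = Clause → Set

⟦_⟧ : ClauseSet → ClausePred
⟦ F ⟧ C = C ∈ F

_⊆ᶜ_ : Clause → Clause → Set
C ⊆ᶜ D = ∀ {x} → x ∈ C → x ∈ D

_≐_ : Clause → Clause → Set
C ≐ D = (C ⊆ᶜ D) × (D ⊆ᶜ C)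

IsClause : Clause → Set
IsClause C = ∀ {x} → x ∈ C → ¬ (compl x ∈ C)

IsClauseSet : ClauseSet → Set
IsClauseSet F = ∀ {C} → C ∈ F → IsClause C

Assignment : Set
Assignment = ℕ → Bool

_⊨ₗ_ : Assignment → Lit → Set
φ ⊨ₗ l = φ (var l) ≡ sign l

_⊨ᶜ_ : Assignment → Clause → Set
φ ⊨ᶜ C = Σ Lit λ l → (l ∈ C) × (φ ⊨ₗ l)

_⊨ₛ_ : Assignment → ClausePred → Set
φ ⊨ₛ S = ∀ C → S C → φ ⊨ᶜ C

_⊫_ : ClausePred → Clause → Set
G ⊫ C = ∀ (φ : Assignment) → φ ⊨ₛ G → φ ⊨ᶜ C

Equivalent : ClausePred → ClausePred → Set
Equivalent S T = ∀ (φ : Assignment) → ((φ ⊨ₛ S → φ ⊨ₛ T) × (φ ⊨ₛ T → φ ⊨ₛ S))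

prc0 : ClausePred → ClausePred
prc0 G C = IsClause C × (G ⊫ C) ×
           (∀ (C' : Clause) → IsClause C' → C' ⊆ᶜ C → G ⊫ C' → C ⊆ᶜ C')

_∖_ : ClausePred → Clause → ClausePred
(S ∖ C) D = S D × ¬ (D ≐ C)

EssentialPI : ClausePred → Clause → Set
EssentialPI G C = prc0 G C × ¬ Equivalent (prc0 G ∖ C) G

VarOf : ClauseSet → ℕ → Set
VarOf F v = Σ Clause λ C → (C ∈ F) × Σ Lit λ l → (l ∈ C) × (var l ≡ v)

IsDoping : ClauseSet → (Clause → ℕ) → Set
IsDoping F u =
  (∀ C → C ∈ F → ¬ VarOf F (u C)) ×
  (∀ C C' → C ∈ F → C' ∈ F → u C ≡ u C' → C ≐ C') ×
  (∀ C C' → C ∈ F → C' ∈ F → C ≐ C' → u C ≡ u C')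

Dop : (Clause → ℕ) → ClauseSet → ClauseSet
Dop u F = map (λ C → lit (u C) true ∷ C) F

-- A doped clause D = {u_C} ∪ C is isolated in D(F): every other clause of D(F)
-- contains a positive literal u_E on a variable outside D. Hence any assignment
-- satisfying D can be extended by "true" outside var(D) to a model of D(F).
-- Extending the assignment that makes exactly one literal x of D true shows that
-- no proper subclause of D is implied, so D is prime. Extending the assignment
-- falsifying D gives a model of every prime implicate P ≠ D: otherwise P ∩ D
-- would already be implied, so P ⊆ D and P = D by primality of D. That model
-- falsifies D, so the prime implicates other than D do not imply D(F).
module Submission where

open import Defs
open import Data.Nat using (ℕ)
open import Data.List.Membership.Propositional using (_∈_)
open import Data.Product using (_×_)

import Data.Nat as ℕ
import Data.Bool as Bool
open import Data.Bool using (true; not)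
open import Data.Bool.Properties using (not-involutive; not-injective; not-¬; ¬-not)
open import Data.List using (List; []; _∷_; map; filter)
open import Data.List.Relation.Unary.Any using (here; there; any?)
open import Data.List.Membership.Propositional using (find; lose)
open import Data.List.Membership.Propositional.Properties
  using (∈-map⁺; ∈-map⁻; ∈-filter⁺; ∈-filter⁻)
open import Data.Product using (_,_; proj₁; proj₂; ∃-syntax)
open import Data.Sum using (_⊎_; inj₁; inj₂)
open import Data.Empty using (⊥-elim)
open import Function using (_∘_)
open import Relation.Nullary using (¬_; yes; no; contradiction)
open import Relation.Binary.Definitions using (DecidableEquality)
open import Relation.Binary.PropositionalEquality using (_≡_; refl; sym; trans; cong; subst)

_≟ₗ_ : DecidableEquality Lit
lit a s ≟ₗ lit b t with a ℕ.≟ b | s Bool.≟ t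
... | yes refl | yes refl = yes refl
... | no a≢b   | _        = no λ { refl → a≢b refl }
... | yes _    | no s≢t   = no λ { refl → s≢t refl }

open import Data.List.Membership.DecPropositional _≟ₗ_ using (_∈?_)
open import Data.List.Membership.DecPropositional ℕ._≟_ using () renaming (_∈?_ to _∈ᵥ?_)

vars : Clause → List ℕ
vars = map var

var-compl : ∀ x → var (compl x) ≡ var x
var-compl (lit _ _) = refl

lit-≡ : ∀ {x y} → var x ≡ var y → sign x ≡ sign y → x ≡ y
lit-≡ {lit _ _} {lit _ _} refl refl = refl

clause-var-injective : ∀ {D} → IsClause D → ∀ {x y} → x ∈ D → y ∈ D → var x ≡ var y → x ≡ y
clause-var-injective {D} clD {lit a s} {lit .a t} x∈D y∈D refl with s Bool.≟ t
... | yes refl = refl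
... | no s≢t   = contradiction (subst (λ b → lit a b ∈ D) (¬-not (s≢t ∘ sym)) y∈D) (clD x∈D)

falsifier : Clause → Assignment
falsifier []      v = true
falsifier (l ∷ L) v with var l ℕ.≟ v
... | yes _ = not (sign l)
... | no _  = falsifier L v

falsifier-witness : ∀ L {v} → v ∈ vars L →
                    ∃[ z ] (z ∈ L × var z ≡ v × falsifier L v ≡ not (sign z))
falsifier-witness (l ∷ L) {v} v∈ with var l ℕ.≟ v
... | yes eq = l , here refl , eq , refl
... | no neq with v∈
...   | here v≡l = contradiction (sym v≡l) neq
...   | there v∈L = let z , z∈L , eq , val = falsifier-witness L v∈L in z , there z∈L , eq , val

falsifier-falsifies : ∀ {D} → IsClause D → ∀ {y} → y ∈ D → ¬ (falsifier D ⊨ₗ y)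
falsifier-falsifies {D} clD {y} y∈D sat with falsifier-witness D (∈-map⁺ var y∈D)
... | z , z∈D , eq , val rewrite clause-var-injective clD z∈D y∈D eq =
  not-¬ refl (trans (sym sat) val)

-- compl x shadows x, so this satisfies x and falsifies the rest of D.
falsifier-flip-satisfies : ∀ x D → falsifier (compl x ∷ D) ⊨ₗ x
falsifier-flip-satisfies (lit a s) D with a ℕ.≟ a
... | yes _ = not-involutive s
... | no a≢a = contradiction refl a≢a

falsifier-flip-only : ∀ {D} → IsClause D → ∀ {x y} → x ∈ D → y ∈ D →
                      falsifier (compl x ∷ D) ⊨ₗ y → y ≡ x
falsifier-flip-only {D} clD {x} {y} x∈D y∈D sat
  with falsifier-witness (compl x ∷ D) (∈-map⁺ var (there {x = compl x} y∈D))
... | z , here refl , eq , _ = clause-var-injective clD y∈D x∈D (trans (sym eq) (var-compl x))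
... | z , there z∈D , eq , val rewrite clause-var-injective clD z∈D y∈D eq =
  contradiction (trans (sym sat) val) (not-¬ refl)

trueOutside : Clause → Assignment → Assignment
trueOutside D ψ v with v ∈ᵥ? vars D
... | yes _ = ψ v
... | no _  = true

trueOutside-inside : ∀ D ψ {v} → v ∈ vars D → trueOutside D ψ v ≡ ψ v
trueOutside-inside D ψ {v} v∈ with v ∈ᵥ? vars D
... | yes _ = refl
... | no v∉ = contradiction v∈ v∉

trueOutside-outside : ∀ D ψ {v} → ¬ v ∈ vars D → trueOutside D ψ v ≡ true
trueOutside-outside D ψ {v} v∉ with v ∈ᵥ? vars D
... | yes v∈ = contradiction v∈ v∉
... | no _  = refl

trueOutside-⊨ₗ : ∀ D ψ {l} → l ∈ D → trueOutside D ψ ⊨ₗ l → ψ ⊨ₗ l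
trueOutside-⊨ₗ D ψ l∈D = trans (sym (trueOutside-inside D ψ (∈-map⁺ var l∈D)))

⊨ₗ-trueOutside : ∀ D ψ {l} → l ∈ D → ψ ⊨ₗ l → trueOutside D ψ ⊨ₗ l
⊨ₗ-trueOutside D ψ l∈D = trans (trueOutside-inside D ψ (∈-map⁺ var l∈D))

-- Off var(D) both assignments are true; on var(D) the second one falsifies exactly D.
∈-of-disagreement : ∀ D ψ {l} → trueOutside D ψ ⊨ₗ l →
                    ¬ (trueOutside D (falsifier D) ⊨ₗ l) → l ∈ D
∈-of-disagreement D ψ {l} sat unsat with var l ∈ᵥ? vars D
... | no _ = contradiction sat unsat
... | yes v∈ with falsifier-witness D v∈
...   | z , z∈D , eq , val = subst (_∈ D) (lit-≡ eq sign≡) z∈D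
  where
  sign≡ : sign z ≡ sign l
  sign≡ = not-injective (¬-not (unsat ∘ trans val))

-- Doping provides this: u_E ∉ var(D(C)) unless u_E = u_C, i.e. D(E) ≐ D(C).
Isolated : ClausePred → Clause → Set
Isolated G D = ∀ E → G E → E ≐ D ⊎ ∃[ v ] (lit v true ∈ E × ¬ v ∈ vars D)

isolated-trueOutside : ∀ {G D} → Isolated G D → ∀ ψ → ψ ⊨ᶜ D → trueOutside D ψ ⊨ₛ G
isolated-trueOutside {D = D} iso ψ (l , l∈D , sat) E E∈G with iso E E∈G
... | inj₁ (_ , D⊆E) = l , D⊆E l∈D , ⊨ₗ-trueOutside D ψ l∈D sat
... | inj₂ (v , v∈E , v∉D) = lit v true , v∈E , trueOutside-outside D ψ v∉D

isolated-prime : ∀ {G D} → IsClause D → G D → Isolated G D → prc0 G D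
isolated-prime {G} {D} clD D∈G iso = clD , (λ φ φ⊨G → φ⊨G D D∈G) , minimal
  where
  minimal : ∀ C → IsClause C → C ⊆ᶜ D → G ⊫ C → D ⊆ᶜ C
  minimal C _ C⊆D G⊫C {x} x∈D with G⊫C (trueOutside D ψ)
                                        (isolated-trueOutside iso ψ (x , x∈D , falsifier-flip-satisfies x D))
    where
    ψ : Assignment
    ψ = falsifier (compl x ∷ D)
  ... | l , l∈C , sat =
    subst (_∈ C) (falsifier-flip-only clD x∈D (C⊆D l∈C) (trueOutside-⊨ₗ D _ (C⊆D l∈C) sat)) l∈C

prime-⊆ : ∀ {G P D} → prc0 G P →
          (∀ φ → φ ⊨ₛ G → ∃[ l ] (l ∈ P × l ∈ D × φ ⊨ₗ l)) → P ⊆ᶜ D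
prime-⊆ {G} {P} {D} (clP , _ , minP) hits = proj₂ ∘ ∈-filter⁻ (_∈? D) {xs = P} ∘ P⊆P∩D
  where
  P∩D⊆P : filter (_∈? D) P ⊆ᶜ P
  P∩D⊆P = proj₁ ∘ ∈-filter⁻ (_∈? D) {xs = P}

  G⊫P∩D : G ⊫ filter (_∈? D) P
  G⊫P∩D φ φ⊨G = let l , l∈P , l∈D , sat = hits φ φ⊨G in l , ∈-filter⁺ (_∈? D) l∈P l∈D , sat

  P⊆P∩D : P ⊆ᶜ filter (_∈? D) P
  P⊆P∩D = minP _ (λ x∈ y∈ → clP (P∩D⊆P x∈) (P∩D⊆P y∈)) P∩D⊆P G⊫P∩D

isolated-falsifier-⊨ : ∀ {G D} → IsClause D → G D → Isolated G D →
                       ∀ P → prc0 G P → ¬ P ≐ D → trueOutside D (falsifier D) ⊨ᶜ P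
isolated-falsifier-⊨ {G} {D} clD D∈G iso P primeP P≉D
  with any? (λ l → trueOutside D (falsifier D) (var l) Bool.≟ sign l) P
... | yes some = find some
... | no none  = ⊥-elim (P≉D (P⊆D , D⊆P))
  where
  P⊆D : P ⊆ᶜ D
  P⊆D = prime-⊆ primeP λ ψ ψ⊨G →
    let l , l∈P , sat = proj₁ (proj₂ primeP) (trueOutside D ψ)
                          (isolated-trueOutside iso ψ (ψ⊨G D D∈G))
        l∈D = ∈-of-disagreement D ψ sat (none ∘ lose l∈P)
    in l , l∈P , l∈D , trueOutside-⊨ₗ D ψ l∈D sat
  D⊆P : D ⊆ᶜ P
  D⊆P = proj₂ (proj₂ (isolated-prime clD D∈G iso)) P (proj₁ primeP) P⊆D (proj₁ (proj₂ primeP))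

isolated-essential : ∀ {G D} → IsClause D → G D → Isolated G D → EssentialPI G D
isolated-essential {G} {D} clD D∈G iso = isolated-prime clD D∈G iso , irredundant
  where
  φ : Assignment
  φ = trueOutside D (falsifier D)

  φ⊨others : φ ⊨ₛ (prc0 G ∖ D)
  φ⊨others P (primeP , P≉D) = isolated-falsifier-⊨ clD D∈G iso P primeP P≉D

  irredundant : ¬ Equivalent (prc0 G ∖ D) G
  irredundant equiv with proj₁ (equiv φ) φ⊨others D D∈G
  ... | l , l∈D , sat = falsifier-falsifies clD l∈D (trueOutside-⊨ₗ D _ l∈D sat)

doped : (Clause → ℕ) → Clause → Clause
doped u C = lit (u C) true ∷ C

∷-≐ : ∀ {x y C D} → x ≡ y → C ≐ D → (x ∷ C) ≐ (y ∷ D)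
∷-≐ refl (C⊆D , D⊆C) = step C⊆D , step D⊆C
  where
  step : ∀ {x C D} → C ⊆ᶜ D → (x ∷ C) ⊆ᶜ (x ∷ D)
  step _   (here eq) = here eq
  step sub (there m) = there (sub m)

module _ {F : ClauseSet} {u : Clause → ℕ} (doping : IsDoping F u) where
  private
    fresh = proj₁ doping
    injective = proj₁ (proj₂ doping)

  doped-isClause : IsClauseSet F → ∀ {C} → C ∈ F → IsClause (doped u C)
  doped-isClause _   C∈F         (here refl) (here ())
  doped-isClause _   {C} C∈F     (here refl) (there m) = fresh C C∈F (C , C∈F , _ , m , refl)
  doped-isClause _   {C} C∈F     (there m)   (here eq) = fresh C C∈F (C , C∈F , _ , m , cong var eq)
  doped-isClause clF C∈F         (there m)   (there m') = clF C∈F m m'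

  doped-isolated : ∀ {C} → C ∈ F → Isolated ⟦ Dop u F ⟧ (doped u C)
  doped-isolated {C} C∈F _ E∈ with ∈-map⁻ (doped u) E∈
  ... | E , E∈F , refl with u E ℕ.≟ u C
  ...   | yes eq = inj₁ (∷-≐ (cong (λ v → lit v true) eq) (injective E C E∈F C∈F eq))
  ...   | no neq = inj₂ (u E , here refl , outside)
    where
    outside : ¬ u E ∈ vars (doped u C)
    outside (here eq) = neq eq
    outside (there m) = let z , z∈C , eq = ∈-map⁻ var m in fresh E E∈F (C , C∈F , z , z∈C , sym eq)

lemma4p15 : (F : ClauseSet) → IsClauseSet F → (u : Clause → ℕ) → IsDoping F u →
    (∀ C → C ∈ Dop u F → prc0 ⟦ Dop u F ⟧ C) ×
    (∀ C → C ∈ Dop u F → EssentialPI ⟦ Dop u F ⟧ C)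
lemma4p15 F clF u doping = (λ C → proj₁ ∘ essential C) , essential
  where
  essential : ∀ C → C ∈ Dop u F → EssentialPI ⟦ Dop u F ⟧ C
  essential _ C∈ with ∈-map⁻ (doped u) C∈
  ... | C , C∈F , refl =
    isolated-essential (doped-isClause doping clF C∈F) (∈-map⁺ (doped u) C∈F) (doped-isolated doping C∈F)
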